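{- Let $n\ge d$ be positive integers. If $\mathcal M$ and $\mathcal M'$ are linkage $(n,d)$-matching fields on $L\sqcup R$ with the same set of Chow covectors, then $\mathcal M=\mathcal M'$.
   Context: $L=\{\ell_1,\dots,\ell_n\}$, $R=\{r_1,\dots,r_d\}$; graphs are identified with edge sets. An $(n,d)$-matching field $\mathcal M=(M_\sigma)$ assigns to each $d$-subset $\sigma\subseteq L$ a perfect matching $M_\sigma$ on $\sigma\sqcup R$; $M_\sigma(\ell_j)$ is the partner of $\ell_j$. It is linkage if for every $(d+1)$-subset $\tau\subseteq L$ the union of the $M_\sigma$ with $\sigma\subset\tau$ is a tree on $\tau\sqcup R$. For an $(n-d+1)$-subset $\rho\subseteq L$, the Chow covector $\Omega_\rho$ is the graph with edges $\{(\ell_j,M_{(L\setminus\rho)\cup\{\ell_j\}}(\ell_j)):\ell_j\in\rho\}$. -}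

module Defs where

open import Data.Nat using (ℕ; suc; _∸_; _≤_; _+_)
open import Data.Fin using (Fin)
open import Data.Fin.Subset using (Subset; _∈_; _⊆_; ∣_∣; ∁; _∪_; ⁅_⁆)
open import Data.Sum using (_⊎_; inj₁; inj₂)
open import Data.Product using (Σ; _×_; _,_; ∃)
open import Data.Unit using (⊤)
open import Data.Empty using (⊥)
open import Data.List using (List; []; _∷_; length; head; last)
open import Data.List.Membership.Propositional using () renaming (_∈_ to _∈ₗ_)
open import Data.List.Relation.Unary.All using (All)
open import Data.List.Relation.Unary.Unique.Propositional using (Unique)
open import Data.Maybe using (Maybe; just; nothing)
open import Relation.Binary.PropositionalEquality using (_≡_)
open import Relation.Nullary using (¬_)

-- Left vertices L = {ℓ_1..ℓ_n} are  Fin n ;  right vertices R = {r_1..r_d} are  Fin d.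
-- A bipartite graph on L ⊔ R is identified with its edge set, a relation
-- E j i  meaning  (ℓ_j , r_i) is an edge.
BGraph : ℕ → ℕ → Set₁
BGraph n d = Fin n → Fin d → Set

_≐_ : ∀ {n d} → BGraph n d → BGraph n d → Set
E ≐ E' = ∀ j i → (E j i → E' j i) × (E' j i → E j i)

-- A family assigning to each subset σ ⊆ L a map σ → R (values outside σ are
-- irrelevant: only the restriction to σ is ever used).
Family : ℕ → ℕ → Set
Family n d = Subset n → Fin n → Fin d

graphOf : ∀ {n d} → Family n d → Subset n → BGraph n d
graphOf M σ j i = (j ∈ σ) × (M σ j ≡ i)

IsPerfectMatching : ∀ {n d} → Subset n → (Fin n → Fin d) → Set
IsPerfectMatching {n} {d} σ m =
  (∀ j k → j ∈ σ → k ∈ σ → m j ≡ m k → j ≡ k)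
  × (∀ (i : Fin d) → Σ (Fin n) λ j → (j ∈ σ) × (m j ≡ i))

IsMatchingField : ∀ {n d} → Family n d → Set
IsMatchingField {n} {d} M = ∀ (σ : Subset n) → ∣ σ ∣ ≡ d → IsPerfectMatching σ (M σ)

SameMatchingField : ∀ {n d} → Family n d → Family n d → Set
SameMatchingField {n} {d} M M' =
  ∀ (σ : Subset n) → ∣ σ ∣ ≡ d → graphOf M σ ≐ graphOf M' σ

Vertex : ℕ → ℕ → Set
Vertex n d = Fin n ⊎ Fin d

InVS : ∀ {n d} → Subset n → Vertex n d → Set
InVS τ (inj₁ j) = j ∈ τ
InVS τ (inj₂ i) = ⊤

Adj : ∀ {n d} → BGraph n d → Vertex n d → Vertex n d → Set
Adj E (inj₁ j) (inj₁ k) = ⊥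
Adj E (inj₁ j) (inj₂ i) = E j i
Adj E (inj₂ i) (inj₁ j) = E j i
Adj E (inj₂ i) (inj₂ k) = ⊥

Chain : ∀ {n d} → BGraph n d → List (Vertex n d) → Set
Chain E [] = ⊤
Chain E (v ∷ []) = ⊤
Chain E (v ∷ w ∷ vs) = Adj E v w × Chain E (w ∷ vs)

Walk : ∀ {n d} → BGraph n d → Vertex n d → Vertex n d → List (Vertex n d) → Set
Walk E u v vs = (head vs ≡ just u) × (last vs ≡ just v) × Chain E vs

IsCycle : ∀ {n d} → BGraph n d → List (Vertex n d) → Set
IsCycle {n} {d} E vs =
  (3 ≤ length vs) × Unique vs × Chain E vs
  × (Σ (Vertex n d) λ u → Σ (Vertex n d) λ w →
       (head vs ≡ just u) × (last vs ≡ just w) × Adj E w u)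

IsTreeOn : ∀ {n d} → Subset n → BGraph n d → Set
IsTreeOn {n} {d} τ E =
  (∀ j i → E j i → j ∈ τ)
  × (∀ (u v : Vertex n d) → InVS τ u → InVS τ v →
       Σ (List (Vertex n d)) λ vs → Walk E u v vs)
  × (∀ (vs : List (Vertex n d)) → ¬ IsCycle E vs)

unionBelow : ∀ {n d} → Family n d → Subset n → BGraph n d
unionBelow {n} {d} M τ j i =
  Σ (Subset n) λ σ → (σ ⊆ τ) × (∣ σ ∣ ≡ d) × graphOf M σ j i

IsLinkage : ∀ {n d} → Family n d → Set
IsLinkage {n} {d} M =
  ∀ (τ : Subset n) → ∣ τ ∣ ≡ suc d → IsTreeOn τ (unionBelow M τ)

chow : ∀ {n d} → Family n d → Subset n → BGraph n d
chow M ρ j i = (j ∈ ρ) × (M (∁ ρ ∪ ⁅ j ⁆) j ≡ i)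

IsChowCovector : ∀ {n d} → Family n d → BGraph n d → Set
IsChowCovector {n} {d} M G =
  Σ (Subset n) λ ρ → (∣ ρ ∣ ≡ n ∸ d + 1) × (chow M ρ ≐ G)

SameChowCovectors : ∀ {n d} → Family n d → Family n d → Set₁
SameChowCovectors {n} {d} M M' =
  (∀ (G : BGraph n d) → IsChowCovector M G → IsChowCovector M' G)
  × (∀ (G : BGraph n d) → IsChowCovector M' G → IsChowCovector M G)

module Submission where

-- Fix a d-subset σ ⊆ L and ℓ_j ∈ σ, and put ρ = (L ∖ σ) ∪ {ℓ_j}, an
-- (n-d+1)-subset.  Since (L ∖ ρ) ∪ {ℓ_j} = σ, the Chow covector Ω_ρ of M
-- has at ℓ_j exactly the edge (ℓ_j , M_σ(ℓ_j)).  A Chow covector Ω_ρ also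
-- remembers its index: its left vertices are precisely ρ.  So if Ω_ρ(M) is
-- a Chow covector Ω_ρ'(M') of M', then ρ' = ρ, and comparing the edges at
-- ℓ_j gives M_σ(ℓ_j) = M'_σ(ℓ_j).  Hence M_σ = M'_σ for every d-subset σ.

open import Defs
open import Data.Nat using (ℕ; _≤_; suc; _∸_; _+_)
open import Data.Nat.Properties using (+-comm)
open import Data.Fin using (Fin; zero) renaming (suc to fsuc)
open import Data.Fin.Properties using (_≟_)
open import Data.Fin.Subset using (Subset; _∈_; _∉_; ∣_∣; ∁; _∪_; ⁅_⁆; inside; outside)
open import Data.Fin.Subset.Properties
  using (∪-identityʳ; x∈p∪q⁺; x∈p∪q⁻; x∈⁅x⁆; x∈⁅y⁆⇒x≡y; x∈∁p⇒x∉p; x∉∁p⇒x∈p; x∉p⇒x∈∁p; x∈p⇒x∉∁p; ⊆-antisym; ∣∁p∣≡n∸∣p∣)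
open import Data.Vec.Base using (_∷_; here; there)
open import Data.Sum using (inj₁; inj₂)
open import Data.Product using (_,_; proj₁; proj₂)
open import Relation.Nullary using (yes; no)
open import Relation.Nullary.Negation using (contradiction)
open import Relation.Binary.PropositionalEquality

∣p∪⁅x⁆∣≡1+∣p∣ : ∀ {n} (p : Subset n) (x : Fin n) → x ∉ p → ∣ p ∪ ⁅ x ⁆ ∣ ≡ suc ∣ p ∣
∣p∪⁅x⁆∣≡1+∣p∣ (outside ∷ p) zero     x∉p = cong suc (cong ∣_∣ (∪-identityʳ p))
∣p∪⁅x⁆∣≡1+∣p∣ (inside ∷ p)  zero     x∉p = contradiction here x∉p
∣p∪⁅x⁆∣≡1+∣p∣ (outside ∷ p) (fsuc x) x∉p = ∣p∪⁅x⁆∣≡1+∣p∣ p x (λ x∈p → x∉p (there x∈p))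
∣p∪⁅x⁆∣≡1+∣p∣ (inside ∷ p)  (fsuc x) x∉p = cong suc (∣p∪⁅x⁆∣≡1+∣p∣ p x (λ x∈p → x∉p (there x∈p)))

chowIndex : ∀ {n} → Subset n → Fin n → Subset n
chowIndex σ j = ∁ σ ∪ ⁅ j ⁆

∈chowIndex : ∀ {n} (σ : Subset n) (j : Fin n) → j ∈ chowIndex σ j
∈chowIndex σ j = x∈p∪q⁺ (inj₂ (x∈⁅x⁆ j))

∣chowIndex∣ : ∀ {n d} (σ : Subset n) (j : Fin n) → j ∈ σ → ∣ σ ∣ ≡ d →
              ∣ chowIndex σ j ∣ ≡ n ∸ d + 1
∣chowIndex∣ {n} {d} σ j j∈σ ∣σ∣≡d = begin
  ∣ ∁ σ ∪ ⁅ j ⁆ ∣  ≡⟨ ∣p∪⁅x⁆∣≡1+∣p∣ (∁ σ) j (x∈p⇒x∉∁p j∈σ) ⟩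
  suc ∣ ∁ σ ∣      ≡⟨ cong suc (∣∁p∣≡n∸∣p∣ σ) ⟩
  suc (n ∸ ∣ σ ∣)  ≡⟨ cong (λ k → suc (n ∸ k)) ∣σ∣≡d ⟩
  suc (n ∸ d)      ≡⟨ +-comm 1 (n ∸ d) ⟩
  n ∸ d + 1        ∎
  where open ≡-Reasoning

-- The Chow covector Ω_ρ at ℓ_j reads off M on (L ∖ ρ) ∪ {ℓ_j}; for
-- ρ = chowIndex σ j this set is σ again.
chowIndex-recovers : ∀ {n} (σ : Subset n) (j : Fin n) → j ∈ σ →
                     ∁ (chowIndex σ j) ∪ ⁅ j ⁆ ≡ σ
chowIndex-recovers σ j j∈σ = ⊆-antisym ⊆σ σ⊆
  where
  ⊆σ : ∀ {x} → x ∈ ∁ (chowIndex σ j) ∪ ⁅ j ⁆ → x ∈ σ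
  ⊆σ x∈ with x∈p∪q⁻ _ _ x∈
  ... | inj₁ x∈∁ρ = x∉∁p⇒x∈p (λ x∈∁σ → x∈∁p⇒x∉p x∈∁ρ (x∈p∪q⁺ (inj₁ x∈∁σ)))
  ... | inj₂ x∈j = subst (_∈ σ) (sym (x∈⁅y⁆⇒x≡y j x∈j)) j∈σ

  σ⊆ : ∀ {x} → x ∈ σ → x ∈ ∁ (chowIndex σ j) ∪ ⁅ j ⁆
  σ⊆ {x} x∈σ with x ≟ j
  ... | yes refl = ∈chowIndex (chowIndex σ j) j
  ... | no x≢j   = x∈p∪q⁺ (inj₁ (x∉p⇒x∈∁p x∉ρ))
    where
    x∉ρ : x ∉ chowIndex σ j
    x∉ρ x∈ρ with x∈p∪q⁻ (∁ σ) ⁅ j ⁆ x∈ρ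
    ... | inj₁ x∈∁σ = x∈∁p⇒x∉p x∈∁σ x∈σ
    ... | inj₂ x∈j  = x≢j (x∈⁅y⁆⇒x≡y j x∈j)

≐-refl : ∀ {n d} (E : BGraph n d) → E ≐ E
≐-refl E j i = (λ e → e) , (λ e → e)

≐-sym : ∀ {n d} {E E' : BGraph n d} → E ≐ E' → E' ≐ E
≐-sym E≐E' j i = proj₂ (E≐E' j i) , proj₁ (E≐E' j i)

chow-edge : ∀ {n d} (M : Family n d) (ρ : Subset n) (j : Fin n) → j ∈ ρ →
            chow M ρ j (M (∁ ρ ∪ ⁅ j ⁆) j)
chow-edge M ρ j j∈ρ = j∈ρ , refl

-- A Chow covector determines its index: the left vertices of Ω_ρ are exactly ρ.
chow-index-unique : ∀ {n d} (M M' : Family n d) (ρ ρ' : Subset n) →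
                    chow M ρ ≐ chow M' ρ' → ρ ≡ ρ'
chow-index-unique M M' ρ ρ' Ω≐Ω' = ⊆-antisym
  (λ {j} j∈ρ  → proj₁ (proj₁ (Ω≐Ω' j _) (chow-edge M ρ j j∈ρ)))
  (λ {j} j∈ρ' → proj₁ (proj₂ (Ω≐Ω' j _) (chow-edge M' ρ' j j∈ρ')))

chow-rigid : ∀ {n d} (M M' : Family n d) (ρ ρ' : Subset n) →
             chow M ρ ≐ chow M' ρ' → (j : Fin n) → j ∈ ρ →
             M (∁ ρ ∪ ⁅ j ⁆) j ≡ M' (∁ ρ ∪ ⁅ j ⁆) j
chow-rigid M M' ρ ρ' Ω≐Ω' j j∈ρ with chow-index-unique M M' ρ ρ' Ω≐Ω'
... | refl = sym (proj₂ (proj₁ (Ω≐Ω' j _) (chow-edge M ρ j j∈ρ)))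

sameChow⇒sameValue : ∀ {n d} (M M' : Family n d) → SameChowCovectors M M' →
                     (σ : Subset n) → ∣ σ ∣ ≡ d → (j : Fin n) → j ∈ σ →
                     M σ j ≡ M' σ j
sameChow⇒sameValue M M' (M⊆M' , _) σ ∣σ∣≡d j j∈σ
  with M⊆M' (chow M (chowIndex σ j)) (chowIndex σ j , ∣chowIndex∣ σ j j∈σ ∣σ∣≡d , ≐-refl _)
... | ρ' , _ , Ω'≐Ω =
  subst (λ s → M s j ≡ M' s j) (chowIndex-recovers σ j j∈σ)
    (chow-rigid M M' (chowIndex σ j) ρ' (≐-sym Ω'≐Ω) j (∈chowIndex σ j))

graphOf-cong : ∀ {n d} (M M' : Family n d) (σ : Subset n) →
               (∀ j → j ∈ σ → M σ j ≡ M' σ j) → graphOf M σ ≐ graphOf M' σ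
graphOf-cong M M' σ agree j i =
  (λ (j∈σ , e) → j∈σ , trans (sym (agree j j∈σ)) e) ,
  (λ (j∈σ , e) → j∈σ , trans (agree j j∈σ) e)

corollary3p24 : (n d : ℕ) → 1 ≤ d → d ≤ n →
    (M M' : Family n d) →
    IsMatchingField M → IsLinkage M →
    IsMatchingField M' → IsLinkage M' →
    SameChowCovectors M M' →
    SameMatchingField M M'
corollary3p24 n d _ _ M M' _ _ _ _ sameChow σ ∣σ∣≡d =
  graphOf-cong M M' σ (sameChow⇒sameValue M M' sameChow σ ∣σ∣≡d)
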